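{- Let $\ell$ be a positive integer, let $\lambda$ be an integer partition with $\lambda_1\le\ell$, and let $q$ be a parameter. Then, in $\mathbb Z(q)[x_1,\dots,x_\ell]$, $$R_\lambda(x;q)=\sum_{\mu\subseteq\lambda}x_1^{\mu'_1-\mu'_2}\cdots x_{\ell-1}^{\mu'_{\ell-1}-\mu'_\ell}x_\ell^{\mu'_\ell}\,(-1)^{|\lambda|-|\mu|}\,q^{\sum_{i=1}^{\ell}\binom{\lambda'_i-\mu'_i}{2}}\,q^{\lambda'_2(\lambda'_1-\mu'_1)+\cdots+\lambda'_\ell(\lambda'_{\ell-1}-\mu'_{\ell-1})}\prod_{i\ge1}\begin{bmatrix}\lambda'_i-\lambda'_{i+1}\\ \lambda'_i-\mu'_i\end{bmatrix}_q.$$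
   Context: For a partition $\lambda$, $\lambda'$ is its conjugate partition ($\lambda'_i=\#\{j:\lambda_j\ge i\}$), $|\lambda|=\sum\lambda_i$, and $\mu\subseteq\lambda$ means $\mu_i\le\lambda_i$ for all $i$ (equivalently $\mu'_i\le\lambda'_i$ for all $i$). The $q$-shifted factorial is $(a;q)_k=(1-a)(1-aq)\cdots(1-aq^{k-1})$ for $k\ge0$ (with $(a;q)_0=1$), abbreviated $(a)_k$, and the $q$-binomial coefficient is $\begin{bmatrix}n\\k\end{bmatrix}_q=\frac{(q)_n}{(q)_k(q)_{n-k}}$. For variables $x=\{x_1,\dots,x_\ell\}$, with the convention $x_0:=1$, and a partition $\lambda$ with $\lambda_1\le\ell$, define $$R_\lambda(x;t)=\prod_{i=1}^{\ell}\prod_{j=\lambda'_{i+1}}^{\lambda'_i-1}(x_i-t^jx_{i-1}).$$ -}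

module Defs where

open import Level using (Level)
open import Data.Nat using (ℕ; zero; suc; _∸_; _≤_; _≥_; _≤?_) renaming (_+_ to _+ℕ_; _*_ to _*ℕ_)
open import Data.Nat.Combinatorics using (_C_)
open import Data.List using (List; []; _∷_; length; filter; map; upTo; foldr)
open import Data.Nat.ListAction using (sum)
open import Data.List.Relation.Unary.All using (All)
open import Data.List.Relation.Unary.Linked using (Linked)
open import Data.List.Relation.Unary.Unique.Propositional using (Unique)
open import Data.List.Membership.Propositional using (_∈_)
open import Data.Vec using (Vec; toList)
open import Data.Product using (_×_)
open import Algebra.Bundles using (CommutativeRing)

IsPartition : List ℕ → Set
IsPartition p = Linked _≥_ p × All (λ a → 1 ≤ a) p

-- i-th part (1-indexed), 0 beyond the length (and for i = 0, unused)
part : List ℕ → ℕ → ℕ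
part []       _             = 0
part (a ∷ p)  zero          = 0
part (a ∷ p)  (suc zero)    = a
part (a ∷ p)  (suc (suc i)) = part p (suc i)

_⊆ₚ_ : List ℕ → List ℕ → Set
μ ⊆ₚ λp = ∀ i → part μ i ≤ part λp i

firstPart : List ℕ → ℕ
firstPart p = part p 1

conj : List ℕ → ℕ → ℕ
conj p i = length (filter (i ≤?_) p)

size : List ℕ → ℕ
size p = sum p

fromTo : ℕ → ℕ → List ℕ
fromTo a b = map (a +ℕ_) (upTo (b ∸ a))

module _ {c ℓ : Level} (R : CommutativeRing c ℓ) where
  open CommutativeRing R

  pow : Carrier → ℕ → Carrier
  pow a zero    = 1#
  pow a (suc n) = a * pow a n

  prodL : List Carrier → Carrier
  prodL = foldr _*_ 1#

  sumL : List Carrier → Carrier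
  sumL = foldr _+_ 0#

  prodRange : ℕ → ℕ → (ℕ → Carrier) → Carrier
  prodRange a b f = prodL (map f (fromTo a b))

  -- x₀ := 1, xᵢ = i-th entry of the list (1-indexed)
  var : List Carrier → ℕ → Carrier
  var _        zero          = 1#
  var []       (suc _)       = 1#
  var (y ∷ ys) (suc zero)    = y
  var (y ∷ ys) (suc (suc i)) = var ys (suc i)

  -- Gaussian binomial [n k]_q, as the polynomial in q given by the
  -- q-Pascal recursion (equal to (q)_n / ((q)_k (q)_{n-k}); 0 if k > n)
  qbinom : Carrier → ℕ → ℕ → Carrier
  qbinom q n       zero    = 1#
  qbinom q zero    (suc k) = 0#
  qbinom q (suc n) (suc k) = qbinom q n k + pow q (suc k) * qbinom q n (suc k)

  Rpoly : (l : ℕ) → List ℕ → Vec Carrier l → Carrier → Carrier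
  Rpoly l p x t =
    prodRange 1 (suc l) λ i →
      prodRange (conj p (suc i)) (conj p i) λ j →
        var (toList x) i - pow t j * var (toList x) (i ∸ 1)

  term : (l : ℕ) → List ℕ → Vec Carrier l → Carrier → List ℕ → Carrier
  term l p x q μ =
    (prodRange 1 l (λ i → pow (var xs i) (conj μ i ∸ conj μ (suc i)))
      * pow (var xs l) (conj μ l))
    * pow (- 1#) (size p ∸ size μ)
    * pow q (sum (map (λ i → (conj p i ∸ conj μ i) C 2) (fromTo 1 (suc l))))
    * pow q (sum (map (λ i → conj p (suc i) *ℕ (conj p i ∸ conj μ i)) (fromTo 1 l)))
    * prodRange 1 (suc l) (λ i → qbinom q (conj p i ∸ conj p (suc i)) (conj p i ∸ conj μ i))
    where xs = toList x

  EnumeratesSubpartitions : List ℕ → List (List ℕ) → Set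
  EnumeratesSubpartitions p L =
    Unique L × (∀ μ → (μ ∈ L → IsPartition μ × μ ⊆ₚ p) × (IsPartition μ × μ ⊆ₚ p → μ ∈ L))

module Submission where

-- Each factor ∏_{j=λ'ᵢ₊₁}^{λ'ᵢ-1} (xᵢ - q^j xᵢ₋₁) of R_λ expands, by the q-binomial theorem, into
-- Σ_{kᵢ=0}^{mᵢ} xᵢ^(mᵢ-kᵢ) xᵢ₋₁^kᵢ (-1)^kᵢ q^(C(kᵢ,2) + λ'ᵢ₊₁ kᵢ) [mᵢ kᵢ]_q with mᵢ = λ'ᵢ - λ'ᵢ₊₁.
-- Multiplying out, the tuples (k₁, …, k_ℓ) with kᵢ ≤ mᵢ correspond, via μ'ᵢ = λ'ᵢ - kᵢ, to the
-- μ ⊆ λ for which λ/μ is a vertical strip, and the product of the chosen terms is the summand of μ.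
-- For every other μ ⊆ λ some λ'ᵢ - μ'ᵢ exceeds mᵢ, so its summand has a vanishing q-binomial factor.

open import Defs
open import Level using (Level)
open import Data.Nat using (ℕ; suc; _≤_)
open import Data.List using (List; map)
open import Data.Vec using (Vec)
open import Algebra.Bundles using (CommutativeRing)

module Range where

  open import Data.Nat using (zero; suc; _+_; _∸_; _<_; z<s)
  open import Data.Nat.Properties
  open import Data.List using ([]; _∷_; _∷ʳ_; applyUpTo)
  open import Data.List.Properties using (map-upTo)
  open import Data.List.Membership.Propositional using (_∈_)
  open import Data.List.Relation.Unary.Any using (here; there)
  open import Data.List.Relation.Unary.All using (All; tabulate)
  open import Data.List.Relation.Unary.Unique.Propositional using (Unique)
  import Data.List.Relation.Unary.Unique.Propositional.Properties as Unique
  open import Data.Product using (_×_; _,_)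
  open import Function using (_∘_)
  open import Relation.Binary.PropositionalEquality
  open import Relation.Nullary using (yes; no; contradiction)

  range : ℕ → ℕ → List ℕ
  range s zero    = []
  range s (suc c) = s ∷ range (suc s) c

  applyUpTo≡range : ∀ (f : ℕ → ℕ) s c → (∀ i → f i ≡ s + i) → applyUpTo f c ≡ range s c
  applyUpTo≡range f s zero    f≡ = refl
  applyUpTo≡range f s (suc c) f≡ = cong₂ _∷_ (trans (f≡ 0) (+-identityʳ s))
    (applyUpTo≡range (f ∘ suc) (suc s) c (λ i → trans (f≡ (suc i)) (+-suc s i)))

  fromTo≡range : ∀ a b → fromTo a b ≡ range a (b ∸ a)
  fromTo≡range a b = trans (map-upTo (a +_) (b ∸ a)) (applyUpTo≡range (a +_) a (b ∸ a) (λ _ → refl))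

  map-range-suc : ∀ {a} {A : Set a} (f : ℕ → A) s c → map f (range (suc s) c) ≡ map (f ∘ suc) (range s c)
  map-range-suc f s zero    = refl
  map-range-suc f s (suc c) = cong (f (suc s) ∷_) (map-range-suc f (suc s) c)

  range-∷ʳ : ∀ s c → range s (suc c) ≡ range s c ∷ʳ (s + c)
  range-∷ʳ s zero    = cong (_∷ []) (sym (+-identityʳ s))
  range-∷ʳ s (suc c) = cong (s ∷_) (trans (range-∷ʳ (suc s) c) (cong (range (suc s) c ∷ʳ_) (sym (+-suc s c))))

  ∈-range⁻ : ∀ {i} s c → i ∈ range s c → s ≤ i × i < s + c
  ∈-range⁻ s (suc c) (here refl) = ≤-refl , m<m+n s z<s
  ∈-range⁻ {i} s (suc c) (there i∈) with s<i , i< ← ∈-range⁻ (suc s) c i∈ =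
    <⇒≤ s<i , subst (i <_) (sym (+-suc s c)) i<

  ∈-range⁺ : ∀ {i} s c → s ≤ i → i < s + c → i ∈ range s c
  ∈-range⁺ {i} s zero    s≤i i< = contradiction i< (≤⇒≯ (subst (_≤ i) (sym (+-identityʳ s)) s≤i))
  ∈-range⁺ {i} s (suc c) s≤i i< with s ≟ i
  ... | yes refl = here refl
  ... | no s≢i = there (∈-range⁺ (suc s) c (≤∧≢⇒< s≤i s≢i) (subst (i <_) (+-suc s c) i<))

  All-range : ∀ {p} {P : ℕ → Set p} s c → (∀ {i} → s ≤ i → i < s + c → P i) → All P (range s c)
  All-range s c P-in = tabulate λ i∈ → let s≤i , i< = ∈-range⁻ s c i∈ in P-in s≤i i<

  range-unique : ∀ s c → Unique (range s c)
  range-unique s c = subst Unique (applyUpTo≡range (s +_) s c (λ _ → refl))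
    (Unique.applyUpTo⁺₁ (s +_) c (λ i<j _ s+i≡s+j → <⇒≢ i<j (+-cancelˡ-≡ s _ _ s+i≡s+j)))

module Conjugate where

  open import Data.Nat using (zero; suc; _+_; _∸_; _<_; _≥_; _≤?_; _<?_; _≤ᵇ_; z≤n; s≤s)
  open import Data.Nat.Properties
  open import Data.Nat.ListAction using (sum)
  open import Data.List using ([]; _∷_)
  open import Data.List.Properties using (map-cong)
  open import Data.List.Relation.Unary.All as All using (All; []; _∷_)
  open import Data.List.Relation.Unary.All.Properties using (map⁺)
  open import Data.List.Relation.Unary.Linked using (Linked; []; [-]; _∷_)
  import Data.List.Relation.Unary.Linked as Linked
  open import Data.List.Relation.Unary.Linked.Properties using (Linked⇒All)
  open import Data.Bool using (true; false)
  open import Data.Unit using (tt)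
  open import Data.Product using (_×_; _,_; proj₁; proj₂)
  open import Function using (_∘_)
  open import Relation.Nullary using (yes; no; contradiction)
  open import Relation.Binary.PropositionalEquality
  open Range

  conj-∷-≤ : ∀ {i a} μ → i ≤ a → conj (a ∷ μ) i ≡ suc (conj μ i)
  conj-∷-≤ {i} {a} μ i≤a with i ≤ᵇ a | ≤⇒≤ᵇ i≤a
  ... | true | _ = refl

  conj-∷-> : ∀ {i a} μ → a < i → conj (a ∷ μ) i ≡ conj μ i
  conj-∷-> {i} {a} μ a<i with i ≤ᵇ a | ≤ᵇ⇒≤ i a
  ... | true  | i≤a = contradiction (i≤a tt) (<⇒≱ a<i)
  ... | false | _   = refl

  conj-all-< : ∀ {i a} μ → All (_≤ a) μ → a < i → conj μ i ≡ 0
  conj-all-< []      []           a<i = refl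
  conj-all-< (b ∷ μ) (b≤a ∷ μ≤a) a<i = trans (conj-∷-> μ (≤-<-trans b≤a a<i)) (conj-all-< μ μ≤a a<i)

  part-≤ : ∀ {a} μ → All (_≤ a) μ → ∀ j → part μ j ≤ a
  part-≤ []      _           j             = z≤n
  part-≤ (b ∷ μ) _           zero          = z≤n
  part-≤ (b ∷ μ) (b≤a ∷ _)   (suc zero)    = b≤a
  part-≤ (b ∷ μ) (_ ∷ μ≤a)   (suc (suc j)) = part-≤ μ μ≤a (suc j)

  parts-≤-head : ∀ {a} μ → Linked _≥_ (a ∷ μ) → All (_≤ a) (a ∷ μ)
  parts-≤-head μ = Linked⇒All (λ a≥b b≥c → ≤-trans b≥c a≥b) ≤-refl

  conj-duality : ∀ μ → Linked _≥_ μ → ∀ i j →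
    (suc j ≤ conj μ (suc i) → suc i ≤ part μ (suc j)) × (suc i ≤ part μ (suc j) → suc j ≤ conj μ (suc i))
  conj-duality []      _  i j = (λ ()) , (λ ())
  conj-duality (a ∷ μ) lk i j with suc i ≤? a
  conj-duality (a ∷ μ) lk i zero    | yes i<a =
    (λ _ → i<a) , (λ _ → subst (1 ≤_) (sym (conj-∷-≤ μ i<a)) (s≤s z≤n))
  conj-duality (a ∷ μ) lk i (suc j) | yes i<a =
    (λ j<μ' → to (≤-pred (subst (suc (suc j) ≤_) (conj-∷-≤ μ i<a) j<μ'))) ,
    (λ i<μ → subst (suc (suc j) ≤_) (sym (conj-∷-≤ μ i<a)) (s≤s (from i<μ)))
    where
    to   = proj₁ (conj-duality μ (Linked.tail lk) i j)
    from = proj₂ (conj-duality μ (Linked.tail lk) i j)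
  conj-duality (a ∷ μ) lk i j       | no i≮a =
    (λ j<μ' → contradiction (≤-trans j<μ' (≤-reflexive (conj-all-< (a ∷ μ) (parts-≤-head μ lk) a<i))) λ ()) ,
    (λ i<μ → contradiction (≤-trans i<μ (part-≤ (a ∷ μ) (parts-≤-head μ lk) (suc j))) i≮a)
    where a<i = ≰⇒> i≮a

  conj-antitone : ∀ μ {i i'} → i ≤ i' → conj μ i' ≤ conj μ i
  conj-antitone []      i≤i' = z≤n
  conj-antitone (a ∷ μ) {i} {i'} i≤i' with i' ≤? a | i ≤? a
  ... | yes i'≤a | yes i≤a = subst₂ _≤_ (sym (conj-∷-≤ μ i'≤a)) (sym (conj-∷-≤ μ i≤a)) (s≤s (conj-antitone μ i≤i'))
  ... | yes i'≤a | no  i≰a = contradiction (≤-trans i≤i' i'≤a) i≰a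
  ... | no  i'≰a | yes i≤a =
    subst₂ _≤_ (sym (conj-∷-> μ (≰⇒> i'≰a))) (sym (conj-∷-≤ μ i≤a)) (m≤n⇒m≤1+n (conj-antitone μ i≤i'))
  ... | no  i'≰a | no  i≰a = subst₂ _≤_ (sym (conj-∷-> μ (≰⇒> i'≰a))) (sym (conj-∷-> μ (≰⇒> i≰a))) (conj-antitone μ i≤i')

  ≤-from-suc : ∀ {a b} → (∀ j → suc j ≤ a → suc j ≤ b) → a ≤ b
  ≤-from-suc {zero}  _ = z≤n
  ≤-from-suc {suc a} h = h a ≤-refl

  ≡-from-suc : ∀ {a b} → (∀ j → suc j ≤ a → suc j ≤ b) → (∀ j → suc j ≤ b → suc j ≤ a) → a ≡ b
  ≡-from-suc a≤ b≤ = ≤-antisym (≤-from-suc a≤) (≤-from-suc b≤)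

  conj-beyond : ∀ μ → Linked _≥_ μ → ∀ j → firstPart μ ≤ j → conj μ (suc j) ≡ 0
  conj-beyond []      lk j _      = refl
  conj-beyond (a ∷ μ) lk j a≤j = conj-all-< (a ∷ μ) (parts-≤-head μ lk) (s≤s a≤j)

  part-map-range : ∀ (f : ℕ → ℕ) s c j → j < c → part (map f (range s c)) (suc j) ≡ f (s + j)
  part-map-range f s (suc c) zero    _         = cong f (sym (+-identityʳ s))
  part-map-range f s (suc c) (suc j) (s≤s j<c) = trans (part-map-range f (suc s) c j j<c) (cong f (sym (+-suc s j)))

  part-map-range-≥ : ∀ (f : ℕ → ℕ) s c j → c ≤ j → part (map f (range s c)) (suc j) ≡ 0
  part-map-range-≥ f s zero    j       _         = refl
  part-map-range-≥ f s (suc c) (suc j) (s≤s c≤j) = part-map-range-≥ f (suc s) c j c≤j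

  Linked-map-range : ∀ (f : ℕ → ℕ) s c → (∀ i → f (suc i) ≤ f i) → Linked _≥_ (map f (range s c))
  Linked-map-range f s zero          _ = []
  Linked-map-range f s (suc zero)    _ = [-]
  Linked-map-range f s (suc (suc c)) f↓ = f↓ s ∷ Linked-map-range f (suc s) (suc c) f↓

  conjugate : List ℕ → List ℕ
  conjugate μ = map (conj μ) (range 1 (firstPart μ))

  part-conjugate : ∀ μ → Linked _≥_ μ → ∀ j → part (conjugate μ) (suc j) ≡ conj μ (suc j)
  part-conjugate μ lk j with j <? firstPart μ
  ... | yes j<μ₁ = part-map-range (conj μ) 1 (firstPart μ) j j<μ₁
  ... | no  j≮μ₁ = trans (part-map-range-≥ (conj μ) 1 (firstPart μ) j (≮⇒≥ j≮μ₁)) (sym (conj-beyond μ lk j (≮⇒≥ j≮μ₁)))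

  conjugate-isPartition : ∀ μ → Linked _≥_ μ → IsPartition (conjugate μ)
  conjugate-isPartition μ lk =
    Linked-map-range (conj μ) 1 (firstPart μ) (λ i → conj-antitone μ (n≤1+n i)) ,
    map⁺ (All-range 1 (firstPart μ) λ { {suc i} _ (s≤s i<μ₁) → proj₂ (conj-duality μ lk i 0) i<μ₁ })

  conj-conjugate : ∀ μ → Linked _≥_ μ → ∀ i → conj (conjugate μ) (suc i) ≡ part μ (suc i)
  conj-conjugate μ lk i = ≡-from-suc
    (λ j j<μ'' → proj₁ (conj-duality μ lk j i) (subst (suc i ≤_) (part-conjugate μ lk j) (proj₁ (dual' i j) j<μ'')))
    (λ j j<μᵢ → proj₂ (dual' i j) (subst (suc i ≤_) (sym (part-conjugate μ lk j)) (proj₂ (conj-duality μ lk j i) j<μᵢ)))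
    where dual' = conj-duality (conjugate μ) (proj₁ (conjugate-isPartition μ lk))

  parts-positive-injective : ∀ μ ν → All (1 ≤_) μ → All (1 ≤_) ν → (∀ j → part μ (suc j) ≡ part ν (suc j)) → μ ≡ ν
  parts-positive-injective []      []      _          _          _  = refl
  parts-positive-injective []      (b ∷ ν) _          (0<b ∷ _)  eq = contradiction (subst (1 ≤_) (sym (eq 0)) 0<b) λ ()
  parts-positive-injective (a ∷ μ) []      (0<a ∷ _)  _          eq = contradiction (subst (1 ≤_) (eq 0) 0<a) λ ()
  parts-positive-injective (a ∷ μ) (b ∷ ν) (_ ∷ μ>0)  (_ ∷ ν>0)  eq =
    cong₂ _∷_ (eq 0) (parts-positive-injective μ ν μ>0 ν>0 (eq ∘ suc))

  conj-injective : ∀ μ ν → IsPartition μ → IsPartition ν → (∀ i → conj μ (suc i) ≡ conj ν (suc i)) → μ ≡ ν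
  conj-injective μ ν (lμ , μ>0) (lν , ν>0) eq = parts-positive-injective μ ν μ>0 ν>0 λ j → ≡-from-suc
    (λ i i<μⱼ → proj₁ (conj-duality ν lν i j) (subst (suc j ≤_) (eq i) (proj₂ (conj-duality μ lμ i j) i<μⱼ)))
    (λ i i<νⱼ → proj₁ (conj-duality μ lμ i j) (subst (suc j ≤_) (sym (eq i)) (proj₂ (conj-duality ν lν i j) i<νⱼ)))

  ⊆⇒conj≤ : ∀ μ λp → Linked _≥_ μ → Linked _≥_ λp → μ ⊆ₚ λp → ∀ i → conj μ (suc i) ≤ conj λp (suc i)
  ⊆⇒conj≤ μ λp lμ lλ μ⊆λ i = ≤-from-suc λ j j<μ' →
    proj₂ (conj-duality λp lλ i j) (≤-trans (proj₁ (conj-duality μ lμ i j) j<μ') (μ⊆λ (suc j)))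

  conj≤⇒⊆ : ∀ μ λp → Linked _≥_ μ → Linked _≥_ λp → (∀ i → conj μ (suc i) ≤ conj λp (suc i)) → μ ⊆ₚ λp
  conj≤⇒⊆ []      λp _ _ _ zero = z≤n
  conj≤⇒⊆ (a ∷ μ) λp _ _ _ zero = z≤n
  conj≤⇒⊆ μ λp lμ lλ μ'≤λ' (suc j) = ≤-from-suc λ i i<μⱼ →
    proj₁ (conj-duality λp lλ i j) (≤-trans (proj₂ (conj-duality μ lμ i j) i<μⱼ) (μ'≤λ' i))

  parts-≤ : ∀ {l} μ → Linked _≥_ μ → firstPart μ ≤ l → All (_≤ l) μ
  parts-≤ []      _  _      = []
  parts-≤ (a ∷ μ) lk a≤l = All.map (λ b≤a → ≤-trans b≤a a≤l) (parts-≤-head μ lk)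

  conj-∷ : ∀ a μ i → conj (a ∷ μ) i ≡ conj (a ∷ []) i + conj μ i
  conj-∷ a μ i with i ≤? a
  ... | yes i≤a = trans (conj-∷-≤ μ i≤a) (cong (_+ conj μ i) (sym (conj-∷-≤ [] i≤a)))
  ... | no  i≰a = trans (conj-∷-> μ (≰⇒> i≰a)) (cong (_+ conj μ i) (sym (conj-∷-> [] (≰⇒> i≰a))))

  sum-conj-singleton : ∀ a l → a ≤ l → sum (map (conj (a ∷ [])) (range 1 l)) ≡ a
  sum-conj-singleton zero    l       _         = sum-zero l 0
    where
    sum-zero : ∀ c s → sum (map (conj (0 ∷ [])) (range (suc s) c)) ≡ 0
    sum-zero zero    s = refl
    sum-zero (suc c) s = cong₂ _+_ (conj-∷-> {suc s} {0} [] (s≤s z≤n)) (sum-zero c (suc s))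
  sum-conj-singleton (suc a) (suc l) (s≤s a≤l) = cong₂ _+_ (conj-∷-≤ {1} {suc a} [] (s≤s z≤n)) (begin
    sum (map (conj (suc a ∷ [])) (range 2 l))  ≡⟨ cong sum (map-range-suc (conj (suc a ∷ [])) 1 l) ⟩
    sum (map (conj (suc a ∷ []) ∘ suc) (range 1 l)) ≡⟨ cong sum (map-cong shift (range 1 l)) ⟩
    sum (map (conj (a ∷ [])) (range 1 l))       ≡⟨ sum-conj-singleton a l a≤l ⟩
    a ∎)
    where
    open ≡-Reasoning
    shift : ∀ i → conj (suc a ∷ []) (suc i) ≡ conj (a ∷ []) i
    shift i with i ≤? a
    ... | yes i≤a = trans (conj-∷-≤ [] (s≤s i≤a)) (sym (conj-∷-≤ [] i≤a))
    ... | no  i≰a = trans (conj-∷-> [] (s≤s (≰⇒> i≰a))) (sym (conj-∷-> [] (≰⇒> i≰a)))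

  sum-map-+ : ∀ {A : Set} (f g : A → ℕ) xs → sum (map (λ x → f x + g x) xs) ≡ sum (map f xs) + sum (map g xs)
  sum-map-+ f g []       = refl
  sum-map-+ f g (x ∷ xs) = trans (cong (f x + g x +_) (sum-map-+ f g xs)) (+-interchange (f x) (g x) _ _)
    where open import Algebra.Properties.CommutativeSemigroup +-commutativeSemigroup
            using () renaming (interchange to +-interchange)

  size≡sum-conj : ∀ l μ → All (_≤ l) μ → size μ ≡ sum (map (conj μ) (range 1 l))
  size≡sum-conj l []      [] = sym (sum-zero (range 1 l))
    where
    sum-zero : ∀ is → sum (map (conj []) is) ≡ 0
    sum-zero []       = refl
    sum-zero (_ ∷ is) = sum-zero is
  size≡sum-conj l (a ∷ μ) (a≤l ∷ μ≤l) = begin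
    a + size μ
      ≡⟨ cong₂ _+_ (sym (sum-conj-singleton a l a≤l)) (size≡sum-conj l μ μ≤l) ⟩
    sum (map (conj (a ∷ [])) (range 1 l)) + sum (map (conj μ) (range 1 l))
      ≡⟨ sym (sum-map-+ (conj (a ∷ [])) (conj μ) (range 1 l)) ⟩
    sum (map (λ i → conj (a ∷ []) i + conj μ i) (range 1 l))
      ≡⟨ cong sum (map-cong (λ i → sym (conj-∷ a μ i)) (range 1 l)) ⟩
    sum (map (conj (a ∷ μ)) (range 1 l)) ∎
    where open ≡-Reasoning

  sum-map-∸ : ∀ {A : Set} (f g : A → ℕ) xs → All (λ x → g x ≤ f x) xs →
    sum (map f xs) ∸ sum (map g xs) ≡ sum (map (λ x → f x ∸ g x) xs)
  sum-map-∸ f g []       []              = refl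
  sum-map-∸ f g (x ∷ xs) (gx≤fx ∷ g≤f) = begin
    (f x + F) ∸ (g x + G)                 ≡⟨ cong (λ y → (y + F) ∸ (g x + G)) (sym (m∸n+n≡m gx≤fx)) ⟩
    ((f x ∸ g x) + g x + F) ∸ (g x + G)   ≡⟨ cong (_∸ (g x + G)) (+-assoc (f x ∸ g x) (g x) F) ⟩
    ((f x ∸ g x) + (g x + F)) ∸ (g x + G) ≡⟨ +-∸-assoc (f x ∸ g x) (+-monoʳ-≤ (g x) (sum-mono xs g≤f)) ⟩
    (f x ∸ g x) + ((g x + F) ∸ (g x + G)) ≡⟨ cong ((f x ∸ g x) +_) ([m+n]∸[m+o]≡n∸o (g x) F G) ⟩
    (f x ∸ g x) + (F ∸ G)                 ≡⟨ cong ((f x ∸ g x) +_) (sum-map-∸ f g xs g≤f) ⟩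
    (f x ∸ g x) + sum (map (λ x → f x ∸ g x) xs) ∎
    where
    open ≡-Reasoning
    F = sum (map f xs)
    G = sum (map g xs)
    sum-mono : ∀ ys → All (λ y → g y ≤ f y) ys → sum (map g ys) ≤ sum (map f ys)
    sum-mono []       []           = z≤n
    sum-mono (y ∷ ys) (gy≤fy ∷ g≤f) = +-mono-≤ gy≤fy (sum-mono ys g≤f)

module Box where

  open import Data.Nat using (zero; suc; _+_; _<_; z≤n; s≤s; z<s)
  open import Data.Nat.Properties using (≤-refl; +-identityʳ; +-suc; ≤-pred; m<m+n; <⇒≤)
  open import Data.List using ([]; _∷_; length; cartesianProductWith)
  open import Data.List.Properties using (∷-injective)
  open import Data.List.Membership.Propositional using (_∈_)
  open import Data.List.Membership.Propositional.Properties using (∈-cartesianProductWith⁺; ∈-cartesianProductWith⁻)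
  open import Data.List.Relation.Unary.Any using (here)
  open import Data.List.Relation.Unary.Unique.Propositional using (Unique)
  open import Data.List.Relation.Unary.Unique.Propositional.Properties using (cartesianProductWith⁺)
  open import Data.List.Relation.Unary.AllPairs using ([]; _∷_)
  open import Data.List.Relation.Unary.All using ([])
  open import Data.Empty using (⊥)
  open import Data.Unit using (⊤; tt)
  open import Data.Product using (_×_; _,_; proj₂)
  open import Function using (_∘_)
  open import Relation.Binary.PropositionalEquality
  open Range

  box : (ℕ → ℕ) → ℕ → ℕ → List (List ℕ)
  box N s zero    = [] ∷ []
  box N s (suc c) = cartesianProductWith _∷_ (range 0 (suc (N s))) (box N (suc s) c)

  InBox : (ℕ → ℕ) → ℕ → ℕ → List ℕ → Set
  InBox N s zero    []       = ⊤
  InBox N s zero    (_ ∷ _)  = ⊥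
  InBox N s (suc c) []       = ⊥
  InBox N s (suc c) (k ∷ ks) = k ≤ N s × InBox N (suc s) c ks

  box-unique : ∀ N s c → Unique (box N s c)
  box-unique N s zero    = [] ∷ []
  box-unique N s (suc c) = cartesianProductWith⁺ _∷_ ∷-injective (range-unique 0 (suc (N s))) (box-unique N (suc s) c)

  InBox⇒∈box : ∀ N s c ks → InBox N s c ks → ks ∈ box N s c
  InBox⇒∈box N s zero    []       _          = here refl
  InBox⇒∈box N s (suc c) (k ∷ ks) (k≤ , ks∈) =
    ∈-cartesianProductWith⁺ _∷_ (∈-range⁺ 0 (suc (N s)) z≤n (s≤s k≤)) (InBox⇒∈box N (suc s) c ks ks∈)

  ∈box⇒InBox : ∀ N s c ks → ks ∈ box N s c → InBox N s c ks
  ∈box⇒InBox N s zero    .[] (here refl) = tt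
  ∈box⇒InBox N s (suc c) ks  ks∈
    with k , ks′ , k∈ , ks′∈ , refl ← ∈-cartesianProductWith⁻ _∷_ (range 0 (suc (N s))) (box N (suc s) c) ks∈ =
    ≤-pred (proj₂ (∈-range⁻ 0 (suc (N s)) k∈)) , ∈box⇒InBox N (suc s) c ks′ ks′∈

  InBox-length : ∀ N s c ks → InBox N s c ks → length ks ≡ c
  InBox-length N s zero    []       _          = refl
  InBox-length N s (suc c) (k ∷ ks) (_ , ks∈) = cong suc (InBox-length N (suc s) c ks ks∈)

  InBox-part : ∀ N s c ks → InBox N s c ks → ∀ j → part ks (suc j) ≤ N (s + j)
  InBox-part N s zero    []       _           j       = z≤n
  InBox-part N s (suc c) (k ∷ ks) (k≤ , _)    zero    = subst (λ i → k ≤ N i) (sym (+-identityʳ s)) k≤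
  InBox-part N s (suc c) (k ∷ ks) (_ , ks∈)   (suc j) =
    subst (λ i → part ks (suc j) ≤ N i) (sym (+-suc s j)) (InBox-part N (suc s) c ks ks∈ j)

  InBox-map-range : ∀ N (f : ℕ → ℕ) s c → (∀ {i} → s ≤ i → i < s + c → f i ≤ N i) → InBox N s c (map f (range s c))
  InBox-map-range N f s zero    _    = tt
  InBox-map-range N f s (suc c) f≤N =
    f≤N ≤-refl (m<m+n s z<s) ,
    InBox-map-range N f (suc s) c (λ {i} s<i i< → f≤N (<⇒≤ s<i) (subst (i <_) (sym (+-suc s c)) i<))

  map-part-range : ∀ ks → map (part ks) (range 1 (length ks)) ≡ ks
  map-part-range []       = refl
  map-part-range (k ∷ ks) = cong (k ∷_) (begin
    map (part (k ∷ ks)) (range 2 (length ks))               ≡⟨ map-range-suc (part (k ∷ ks)) 1 (length ks) ⟩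
    map (part (k ∷ ks) ∘ suc) (range 1 (length ks))         ≡⟨ map-range-suc (part (k ∷ ks) ∘ suc) 0 (length ks) ⟩
    map (part ks ∘ suc) (range 0 (length ks))               ≡⟨ map-range-suc (part ks) 0 (length ks) ⟨
    map (part ks) (range 1 (length ks))                     ≡⟨ map-part-range ks ⟩
    ks ∎)
    where open ≡-Reasoning

-- The digits of μ ⊆ λ are kᵢ = λ'ᵢ - μ'ᵢ; they lie in [0, mᵢ], where mᵢ = λ'ᵢ - λ'ᵢ₊₁ is the
-- multiplicity of i in λ, exactly when λ/μ is a vertical strip.
module Digits (l : ℕ) (λp : List ℕ) (λ-isPartition : IsPartition λp) (λ₁≤l : firstPart λp ≤ l) where

  open import Data.Nat using (zero; suc; _+_; _∸_; _<_; _≥_; _<?_; z≤n)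
  open import Data.List.Relation.Unary.Linked using (Linked)
  open import Data.Nat.Properties
  open import Data.List using ([]; _∷_; length)
  open import Data.List.Properties using (map-cong-local)
  open import Data.Nat.ListAction using (sum)
  open import Data.List.Relation.Unary.All as All using (All)
  open import Data.Product using (proj₁)
  open import Relation.Nullary using (yes; no; ¬_)
  open import Relation.Binary.PropositionalEquality
  open Range
  open Conjugate
  open Box

  λ' : ℕ → ℕ
  λ' = conj λp

  mult : ℕ → ℕ
  mult i = λ' i ∸ λ' (suc i)

  λ'-antitone : ∀ i → λ' (suc i) ≤ λ' i
  λ'-antitone i = conj-antitone λp (n≤1+n i)

  λ'-beyond : ∀ j → l ≤ j → λ' (suc j) ≡ 0
  λ'-beyond j l≤j = conj-beyond λp (proj₁ λ-isPartition) j (≤-trans λ₁≤l l≤j)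

  mult≤λ' : ∀ i → mult i ≤ λ' i
  mult≤λ' i = m∸n≤m (λ' i) (λ' (suc i))

  Digits : List ℕ → Set
  Digits = InBox mult 1 l

  digit≤mult : ∀ {ks} → Digits ks → ∀ i → part ks i ≤ mult i
  digit≤mult {[]}     _  i       = z≤n
  digit≤mult {k ∷ ks} _  zero    = z≤n
  digit≤mult {k ∷ ks} ks∈ (suc j) = InBox-part mult 1 l (k ∷ ks) ks∈ j

  digit≤λ' : ∀ {ks} → Digits ks → ∀ i → part ks i ≤ λ' i
  digit≤λ' ks∈ i = ≤-trans (digit≤mult ks∈ i) (mult≤λ' i)

  conjugateFromDigits : List ℕ → List ℕ
  conjugateFromDigits ks = map (λ i → λ' i ∸ part ks i) (range 1 l)

  fromDigits : List ℕ → List ℕ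
  fromDigits ks = conjugate (conjugateFromDigits ks)

  toDigits : List ℕ → List ℕ
  toDigits μ = map (λ i → λ' i ∸ conj μ i) (range 1 l)

  conjugateFromDigits-linked : ∀ {ks} → Digits ks → Linked _≥_ (conjugateFromDigits ks)
  conjugateFromDigits-linked {ks} ks∈ = Linked-map-range _ 1 l λ i →
    ≤-trans (m∸n≤m (λ' (suc i)) (part ks (suc i)))
            (subst (_≤ λ' i ∸ part ks i) (m∸[m∸n]≡n (λ'-antitone i)) (∸-monoʳ-≤ (λ' i) (digit≤mult ks∈ i)))

  conj-fromDigits : ∀ {ks} → Digits ks → ∀ j → conj (fromDigits ks) (suc j) ≡ λ' (suc j) ∸ part ks (suc j)
  conj-fromDigits {ks} ks∈ j with conj-conjugate (conjugateFromDigits ks) (conjugateFromDigits-linked ks∈) j | j <? l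
  ... | eq | yes j<l = trans eq (part-map-range _ 1 l j j<l)
  ... | eq | no  j≮l = begin
    conj (fromDigits ks) (suc j)                  ≡⟨ eq ⟩
    part (conjugateFromDigits ks) (suc j)         ≡⟨ part-map-range-≥ _ 1 l j (≮⇒≥ j≮l) ⟩
    0                                             ≡⟨ 0∸n≡0 (part ks (suc j)) ⟨
    0 ∸ part ks (suc j)                           ≡⟨ cong (_∸ part ks (suc j)) (λ'-beyond j (≮⇒≥ j≮l)) ⟨
    λ' (suc j) ∸ part ks (suc j)                  ∎
    where open ≡-Reasoning

  fromDigits-isPartition : ∀ {ks} → Digits ks → IsPartition (fromDigits ks)
  fromDigits-isPartition ks∈ = conjugate-isPartition _ (conjugateFromDigits-linked ks∈)

  fromDigits-⊆ : ∀ {ks} → Digits ks → fromDigits ks ⊆ₚ λp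
  fromDigits-⊆ {ks} ks∈ = conj≤⇒⊆ _ λp (proj₁ (fromDigits-isPartition ks∈)) (proj₁ λ-isPartition)
    (λ i → subst (_≤ λ' (suc i)) (sym (conj-fromDigits ks∈ i)) (m∸n≤m (λ' (suc i)) (part ks (suc i))))

  digit-fromDigits : ∀ {ks} → Digits ks → ∀ j → λ' (suc j) ∸ conj (fromDigits ks) (suc j) ≡ part ks (suc j)
  digit-fromDigits {ks} ks∈ j = trans (cong (λ' (suc j) ∸_) (conj-fromDigits ks∈ j)) (m∸[m∸n]≡n (digit≤λ' ks∈ (suc j)))

  map-digits-fromDigits : ∀ {a} {A : Set a} {ks} → Digits ks → (f : ℕ → ℕ → A) →
    map (λ i → f i (λ' i ∸ conj (fromDigits ks) i)) (range 1 l) ≡ map (λ i → f i (part ks i)) (range 1 l)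
  map-digits-fromDigits ks∈ f = map-cong-local (All-range 1 l λ { {suc j} _ _ → cong (f (suc j)) (digit-fromDigits ks∈ j) })

  toDigits-fromDigits : ∀ {ks} → Digits ks → toDigits (fromDigits ks) ≡ ks
  toDigits-fromDigits {ks} ks∈ = begin
    toDigits (fromDigits ks)            ≡⟨ map-digits-fromDigits ks∈ (λ _ n → n) ⟩
    map (part ks) (range 1 l)           ≡⟨ cong (λ c → map (part ks) (range 1 c)) (InBox-length mult 1 l ks ks∈) ⟨
    map (part ks) (range 1 (length ks)) ≡⟨ map-part-range ks ⟩
    ks ∎
    where open ≡-Reasoning

  [m+n∸o]∸[m∸p]≡[n∸o]+p : ∀ m n {o p} → o ≤ n → p ≤ m → (m + n) ∸ o ∸ (m ∸ p) ≡ (n ∸ o) + p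
  [m+n∸o]∸[m∸p]≡[n∸o]+p m n {o} {p} o≤n p≤m = begin
    (m + n) ∸ o ∸ (m ∸ p)                 ≡⟨ cong (_∸ (m ∸ p)) (+-∸-assoc m o≤n) ⟩
    (m + (n ∸ o)) ∸ (m ∸ p)               ≡⟨ cong (λ m′ → (m′ + (n ∸ o)) ∸ (m ∸ p)) (sym (m∸n+n≡m p≤m)) ⟩
    ((m ∸ p) + p + (n ∸ o)) ∸ (m ∸ p)     ≡⟨ cong (_∸ (m ∸ p)) (+-assoc (m ∸ p) p (n ∸ o)) ⟩
    ((m ∸ p) + (p + (n ∸ o))) ∸ (m ∸ p)   ≡⟨ m+n∸m≡n (m ∸ p) (p + (n ∸ o)) ⟩
    p + (n ∸ o)                           ≡⟨ +-comm p (n ∸ o) ⟩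
    (n ∸ o) + p                           ∎
    where open ≡-Reasoning

  conj-fromDigits-step : ∀ {ks} → Digits ks → ∀ j →
    conj (fromDigits ks) (suc j) ∸ conj (fromDigits ks) (suc (suc j))
      ≡ (mult (suc j) ∸ part ks (suc j)) + part ks (suc (suc j))
  conj-fromDigits-step {ks} ks∈ j = begin
    conj (fromDigits ks) (suc j) ∸ conj (fromDigits ks) (suc (suc j))
      ≡⟨ cong₂ _∸_ (conj-fromDigits ks∈ j) (conj-fromDigits ks∈ (suc j)) ⟩
    (λ' (suc j) ∸ k₁) ∸ (λ' (suc (suc j)) ∸ k₂)
      ≡⟨ cong (λ n → (n ∸ k₁) ∸ (λ' (suc (suc j)) ∸ k₂)) (sym (m+[n∸m]≡n (λ'-antitone (suc j)))) ⟩
    (λ' (suc (suc j)) + mult (suc j)) ∸ k₁ ∸ (λ' (suc (suc j)) ∸ k₂)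
      ≡⟨ [m+n∸o]∸[m∸p]≡[n∸o]+p _ _ (digit≤mult ks∈ (suc j)) (digit≤λ' ks∈ (suc (suc j))) ⟩
    (mult (suc j) ∸ k₁) + k₂ ∎
    where
    open ≡-Reasoning
    k₁ = part ks (suc j)
    k₂ = part ks (suc (suc j))

  conj-fromDigits-last : ∀ {ks} → Digits ks → ∀ j → l ≤ suc j → conj (fromDigits ks) (suc j) ≡ mult (suc j) ∸ part ks (suc j)
  conj-fromDigits-last {ks} ks∈ j l≤1+j =
    trans (conj-fromDigits ks∈ j) (cong (λ n → (λ' (suc j) ∸ n) ∸ part ks (suc j)) (sym (λ'-beyond (suc j) l≤1+j)))

  -- λ/μ is a vertical strip; for i > l both sides vanish, so only i ≤ l is recorded.
  IsVerticalStrip : List ℕ → Set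
  IsVerticalStrip μ = All (λ i → λ' (suc i) ≤ conj μ i) (range 1 l)

  conj≤λ' : ∀ {μ} → IsPartition μ → μ ⊆ₚ λp → ∀ j → conj μ (suc j) ≤ λ' (suc j)
  conj≤λ' {μ} μ-isPartition μ⊆λ = ⊆⇒conj≤ μ λp (proj₁ μ-isPartition) (proj₁ λ-isPartition) μ⊆λ

  toDigits-digits : ∀ μ → IsVerticalStrip μ → Digits (toDigits μ)
  toDigits-digits μ strip = InBox-map-range mult _ 1 l λ {i} 1≤i i<1+l →
    ∸-monoʳ-≤ (λ' i) (All.lookup strip (∈-range⁺ 1 l 1≤i i<1+l))

  fromDigits-toDigits : ∀ {μ} → IsPartition μ → μ ⊆ₚ λp → IsVerticalStrip μ → fromDigits (toDigits μ) ≡ μ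
  fromDigits-toDigits {μ} μ-isPartition μ⊆λ strip =
    conj-injective _ μ (fromDigits-isPartition ks∈) μ-isPartition λ j → trans (conj-fromDigits ks∈ j) (digit j)
    where
    ks∈ = toDigits-digits μ strip
    digit : ∀ j → λ' (suc j) ∸ part (toDigits μ) (suc j) ≡ conj μ (suc j)
    digit j with j <? l
    ... | yes j<l = trans (cong (λ' (suc j) ∸_) (part-map-range _ 1 l j j<l)) (m∸[m∸n]≡n (conj≤λ' μ-isPartition μ⊆λ j))
    ... | no  j≮l = begin
      λ' (suc j) ∸ part (toDigits μ) (suc j) ≡⟨ cong (_∸ part (toDigits μ) (suc j)) (λ'-beyond j (≮⇒≥ j≮l)) ⟩
      0 ∸ part (toDigits μ) (suc j)          ≡⟨ 0∸n≡0 (part (toDigits μ) (suc j)) ⟩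
      0                                      ≡⟨ n≤0⇒n≡0 (subst (conj μ (suc j) ≤_) (λ'-beyond j (≮⇒≥ j≮l))
                                                                  (conj≤λ' μ-isPartition μ⊆λ j)) ⟨
      conj μ (suc j)                         ∎
      where open ≡-Reasoning

  not-strip⇒mult< : ∀ μ i → ¬ λ' (suc i) ≤ conj μ i → mult i < λ' i ∸ conj μ i
  not-strip⇒mult< μ i not-strip = ∸-monoʳ-< (≰⇒> not-strip) (λ'-antitone i)

  size-fromDigits : ∀ {ks} → Digits ks → size λp ∸ size (fromDigits ks) ≡ sum (map (part ks) (range 1 l))
  size-fromDigits {ks} ks∈ = begin
    size λp ∸ size μ
      ≡⟨ cong₂ _∸_ (size≡sum-conj l λp (parts-≤ λp (proj₁ λ-isPartition) λ₁≤l))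
                   (size≡sum-conj l μ (parts-≤ μ (proj₁ μ-isPartition) (≤-trans (fromDigits-⊆ ks∈ 1) λ₁≤l))) ⟩
    sum (map λ' (range 1 l)) ∸ sum (map (conj μ) (range 1 l))
      ≡⟨ sum-map-∸ λ' (conj μ) (range 1 l) (All-range 1 l λ { {suc j} _ _ → conj≤λ' μ-isPartition (fromDigits-⊆ ks∈) j }) ⟩
    sum (map (λ i → λ' i ∸ conj μ i) (range 1 l))
      ≡⟨ cong sum (map-digits-fromDigits ks∈ (λ _ n → n)) ⟩
    sum (map (part ks) (range 1 l)) ∎
    where
    open ≡-Reasoning
    μ = fromDigits ks
    μ-isPartition = fromDigits-isPartition ks∈

module BigOperators {c ℓ} (R : CommutativeRing c ℓ) where

  open import Data.Nat using (zero; suc) renaming (_+_ to _+ℕ_)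
  import Data.Nat.Properties as ℕ
  open import Data.Nat.ListAction using (sum)
  open import Data.List using ([]; _∷_; _++_; [_]; length; filter; cartesianProductWith)
  open import Data.List.Properties using (map-++; map-∘; map-cong)
  open import Data.List.Membership.Propositional using (_∈_; _∉_)
  open import Data.List.Membership.Propositional.Properties using (∈-filter⁺; ∈-filter⁻)
  import Data.List.Membership.DecPropositional as DecMembership
  open import Data.List.Relation.Unary.Any using (here; there)
  open import Data.List.Relation.Unary.Unique.Propositional using (Unique)
  import Data.List.Relation.Unary.Unique.Propositional.Properties as Unique
  open import Data.List.Relation.Binary.Permutation.Propositional using (_↭_; ↭⇒↭ₛ′)
  import Data.List.Relation.Binary.Permutation.Propositional.Properties as ↭
  open import Data.List.Relation.Binary.Permutation.Setoid.Properties using (foldr-commMonoid)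
  open import Data.List.Relation.Binary.BagAndSetEquality using (∼bag⇒↭)
  open import Data.List.Membership.Propositional.Properties.WithK using (unique∧set⇒bag)
  open import Data.Product using (proj₂)
  open import Function using (_∘_)
  open import Function.Bundles using (_⇔_; mk⇔)
  open import Relation.Nullary using (yes; no; ¬_)
  open import Relation.Binary.Definitions using (DecidableEquality)
  import Relation.Binary.PropositionalEquality as ≡
  open ≡ using (_≡_)
  open CommutativeRing R hiding (zero)
  open import Relation.Binary.Reasoning.Setoid setoid
  open import Algebra.Properties.CommutativeSemigroup +-commutativeSemigroup using () renaming (interchange to +-interchange)
  open import Algebra.Properties.CommutativeSemigroup *-commutativeSemigroup using () renaming (interchange to *-interchange)
  open Range
  open Box

  Σ : List Carrier → Carrier
  Σ = sumL R

  Π : List Carrier → Carrier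
  Π = prodL R

  sumL-++ : ∀ xs ys → Σ (xs ++ ys) ≈ Σ xs + Σ ys
  sumL-++ []       ys = sym (+-identityˡ _)
  sumL-++ (x ∷ xs) ys = trans (+-congˡ (sumL-++ xs ys)) (sym (+-assoc _ _ _))

  prodL-++ : ∀ xs ys → Π (xs ++ ys) ≈ Π xs * Π ys
  prodL-++ []       ys = sym (*-identityˡ _)
  prodL-++ (x ∷ xs) ys = trans (*-congˡ (prodL-++ xs ys)) (sym (*-assoc _ _ _))

  module _ {A : Set} where

    sumL-map-cong : ∀ {f g : A → Carrier} xs → (∀ {x} → x ∈ xs → f x ≈ g x) → Σ (map f xs) ≈ Σ (map g xs)
    sumL-map-cong []       _   = refl
    sumL-map-cong (x ∷ xs) f≈g = +-cong (f≈g (here ≡.refl)) (sumL-map-cong xs (f≈g ∘ there))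

    prodL-map-cong : ∀ {f g : A → Carrier} xs → (∀ {x} → x ∈ xs → f x ≈ g x) → Π (map f xs) ≈ Π (map g xs)
    prodL-map-cong []       _   = refl
    prodL-map-cong (x ∷ xs) f≈g = *-cong (f≈g (here ≡.refl)) (prodL-map-cong xs (f≈g ∘ there))

    sumL-map-+ : ∀ (f g : A → Carrier) xs → Σ (map (λ x → f x + g x) xs) ≈ Σ (map f xs) + Σ (map g xs)
    sumL-map-+ f g []       = sym (+-identityˡ _)
    sumL-map-+ f g (x ∷ xs) = trans (+-congˡ (sumL-map-+ f g xs)) (+-interchange _ _ _ _)

    prodL-map-* : ∀ (f g : A → Carrier) xs → Π (map (λ x → f x * g x) xs) ≈ Π (map f xs) * Π (map g xs)
    prodL-map-* f g []       = sym (*-identityˡ _)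
    prodL-map-* f g (x ∷ xs) = trans (*-congˡ (prodL-map-* f g xs)) (*-interchange _ _ _ _)

    *-sumL-distribˡ : ∀ a (f : A → Carrier) xs → a * Σ (map f xs) ≈ Σ (map (λ x → a * f x) xs)
    *-sumL-distribˡ a f []       = zeroʳ a
    *-sumL-distribˡ a f (x ∷ xs) = trans (distribˡ a _ _) (+-congˡ (*-sumL-distribˡ a f xs))

    *-sumL-distribʳ : ∀ a (f : A → Carrier) xs → Σ (map f xs) * a ≈ Σ (map (λ x → f x * a) xs)
    *-sumL-distribʳ a f []       = zeroˡ a
    *-sumL-distribʳ a f (x ∷ xs) = trans (distribʳ a _ _) (+-congˡ (*-sumL-distribʳ a f xs))

    prodL-map-zero : ∀ (f : A → Carrier) {x} xs → x ∈ xs → f x ≈ 0# → Π (map f xs) ≈ 0#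
    prodL-map-zero f (_ ∷ xs) (here ≡.refl) fx≈0 = trans (*-congʳ fx≈0) (zeroˡ _)
    prodL-map-zero f (_ ∷ xs) (there x∈)    fx≈0 = trans (*-congˡ (prodL-map-zero f xs x∈ fx≈0)) (zeroʳ _)

  pow-+ : ∀ a m n → pow R a (m +ℕ n) ≈ pow R a m * pow R a n
  pow-+ a zero    n = sym (*-identityˡ _)
  pow-+ a (suc m) n = trans (*-congˡ (pow-+ a m n)) (sym (*-assoc _ _ _))

  pow-cong : ∀ a {m n} → m ≡ n → pow R a m ≈ pow R a n
  pow-cong a m≡n = reflexive (≡.cong (pow R a) m≡n)

  pow-1# : ∀ n → pow R 1# n ≈ 1#
  pow-1# zero    = refl
  pow-1# (suc n) = trans (*-identityˡ _) (pow-1# n)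

  pow-sum : ∀ {A : Set} a (g : A → ℕ) xs → pow R a (sum (map g xs)) ≈ Π (map (pow R a ∘ g) xs)
  pow-sum a g []       = refl
  pow-sum a g (x ∷ xs) = trans (pow-+ a (g x) _) (*-congˡ (pow-sum a g xs))

  sumL-map-range-∷ʳ : ∀ (f : ℕ → Carrier) s n → Σ (map f (range s (suc n))) ≈ Σ (map f (range s n)) + f (s +ℕ n)
  sumL-map-range-∷ʳ f s n = begin
    Σ (map f (range s (suc n)))            ≡⟨ ≡.cong (Σ ∘ map f) (range-∷ʳ s n) ⟩
    Σ (map f (range s n ++ [ s +ℕ n ]))    ≡⟨ ≡.cong Σ (map-++ f (range s n) [ s +ℕ n ]) ⟩
    Σ (map f (range s n) ++ [ f (s +ℕ n) ]) ≈⟨ sumL-++ (map f (range s n)) _ ⟩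
    Σ (map f (range s n)) + (f (s +ℕ n) + 0#) ≈⟨ +-congˡ (+-identityʳ _) ⟩
    Σ (map f (range s n)) + f (s +ℕ n)      ∎

  prodL-map-range-∷ʳ : ∀ (f : ℕ → Carrier) s n → Π (map f (range s (suc n))) ≈ Π (map f (range s n)) * f (s +ℕ n)
  prodL-map-range-∷ʳ f s n = begin
    Π (map f (range s (suc n)))            ≡⟨ ≡.cong (Π ∘ map f) (range-∷ʳ s n) ⟩
    Π (map f (range s n ++ [ s +ℕ n ]))    ≡⟨ ≡.cong Π (map-++ f (range s n) [ s +ℕ n ]) ⟩
    Π (map f (range s n) ++ [ f (s +ℕ n) ]) ≈⟨ prodL-++ (map f (range s n)) _ ⟩
    Π (map f (range s n)) * (f (s +ℕ n) * 1#) ≈⟨ *-congˡ (*-identityʳ _) ⟩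
    Π (map f (range s n)) * f (s +ℕ n)      ∎

  sumL-↭ : ∀ {xs ys} → xs ↭ ys → Σ xs ≈ Σ ys
  sumL-↭ xs↭ys = foldr-commMonoid setoid +-isCommutativeMonoid (↭⇒↭ₛ′ isEquivalence xs↭ys)

  module _ {A : Set} (f : A → Carrier) where

    sumL-filter : ∀ {p} {P : A → Set p} P? xs → (∀ {x} → x ∈ xs → ¬ P x → f x ≈ 0#) →
                  Σ (map f xs) ≈ Σ (map f (filter P? xs))
    sumL-filter P? []       _        = refl
    sumL-filter P? (x ∷ xs) f-vanish with P? x
    ... | yes _   = +-congˡ (sumL-filter P? xs (f-vanish ∘ there))
    ... | no  ¬Px = trans (+-cong (f-vanish (here ≡.refl) ¬Px) (sumL-filter P? xs (f-vanish ∘ there))) (+-identityˡ _)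

    sumL-unique-⊆ : DecidableEquality A → ∀ {xs ys} → Unique xs → Unique ys → (∀ {y} → y ∈ ys → y ∈ xs) →
                    (∀ {x} → x ∈ xs → x ∉ ys → f x ≈ 0#) → Σ (map f xs) ≈ Σ (map f ys)
    sumL-unique-⊆ _≟_ {xs} {ys} xs! ys! ys⊆xs f-vanish = begin
      Σ (map f xs)
        ≈⟨ sumL-filter (_∈? ys) xs f-vanish ⟩
      Σ (map f (filter (_∈? ys) xs))
        ≈⟨ sumL-↭ (↭.map⁺ f (∼bag⇒↭ (unique∧set⇒bag (Unique.filter⁺ (_∈? ys) xs!) ys! same-elements))) ⟩
      Σ (map f ys) ∎
      where
      open DecMembership _≟_ using (_∈?_)
      same-elements : ∀ {y} → y ∈ filter (_∈? ys) xs ⇔ y ∈ ys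
      same-elements = mk⇔ (λ y∈ → proj₂ (∈-filter⁻ (_∈? ys) {xs = xs} y∈)) (λ y∈ → ∈-filter⁺ (_∈? ys) (ys⊆xs y∈) y∈)

  sumL-cartesianProduct : ∀ (F : List ℕ → Carrier) ks ts →
    Σ (map F (cartesianProductWith _∷_ ks ts)) ≈ Σ (map (λ k → Σ (map (λ t → F (k ∷ t)) ts)) ks)
  sumL-cartesianProduct F []       ts = refl
  sumL-cartesianProduct F (k ∷ ks) ts = begin
    Σ (map F (map (k ∷_) ts ++ cartesianProductWith _∷_ ks ts))
      ≈⟨ reflexive (≡.cong Σ (map-++ F (map (k ∷_) ts) _)) ⟩
    Σ (map F (map (k ∷_) ts) ++ map F (cartesianProductWith _∷_ ks ts))
      ≈⟨ sumL-++ (map F (map (k ∷_) ts)) _ ⟩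
    Σ (map F (map (k ∷_) ts)) + Σ (map F (cartesianProductWith _∷_ ks ts))
      ≈⟨ +-cong (reflexive (≡.cong Σ (≡.sym (map-∘ ts)))) (sumL-cartesianProduct F ks ts) ⟩
    Σ (map (λ t → F (k ∷ t)) ts) + Σ (map (λ k → Σ (map (λ t → F (k ∷ t)) ts)) ks) ∎

  prodAlong : (ℕ → ℕ → Carrier) → ℕ → List ℕ → Carrier
  prodAlong g s []       = 1#
  prodAlong g s (k ∷ ks) = g s k * prodAlong g (suc s) ks

  prodAlong-part : ∀ g s ks → prodAlong g s ks ≈ Π (map (λ j → g (s +ℕ j) (part ks (suc j))) (range 0 (length ks)))
  prodAlong-part g s []       = refl
  prodAlong-part g s (k ∷ ks) = *-cong (reflexive (≡.cong (λ i → g i k) (≡.sym (ℕ.+-identityʳ s)))) (begin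
    prodAlong g (suc s) ks
      ≈⟨ prodAlong-part g (suc s) ks ⟩
    Π (map (λ j → g (suc s +ℕ j) (part ks (suc j))) (range 0 (length ks)))
      ≡⟨ ≡.cong Π (map-cong (λ j → ≡.cong (λ i → g i (part ks (suc j))) (≡.sym (ℕ.+-suc s j))) (range 0 (length ks))) ⟩
    Π (map (λ j → g (s +ℕ suc j) (part (k ∷ ks) (suc (suc j)))) (range 0 (length ks)))
      ≡⟨ ≡.cong Π (map-range-suc (λ j → g (s +ℕ j) (part (k ∷ ks) (suc j))) 0 (length ks)) ⟨
    Π (map (λ j → g (s +ℕ j) (part (k ∷ ks) (suc j))) (range 1 (length ks))) ∎)

  prodL-sumL≈sumL-box : ∀ (g : ℕ → ℕ → Carrier) N s c →
    Π (map (λ i → Σ (map (g i) (range 0 (suc (N i))))) (range s c)) ≈ Σ (map (prodAlong g s) (box N s c))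
  prodL-sumL≈sumL-box g N s zero    = sym (+-identityʳ _)
  prodL-sumL≈sumL-box g N s (suc c) = begin
    Σ (map (g s) digits) * Π (map (λ i → Σ (map (g i) (range 0 (suc (N i))))) (range (suc s) c))
      ≈⟨ *-congˡ (prodL-sumL≈sumL-box g N (suc s) c) ⟩
    Σ (map (g s) digits) * Σ (map (prodAlong g (suc s)) rest)
      ≈⟨ *-sumL-distribʳ _ (g s) digits ⟩
    Σ (map (λ k → g s k * Σ (map (prodAlong g (suc s)) rest)) digits)
      ≈⟨ sumL-map-cong digits (λ {k} _ → *-sumL-distribˡ (g s k) (prodAlong g (suc s)) rest) ⟩
    Σ (map (λ k → Σ (map (λ t → g s k * prodAlong g (suc s) t) rest)) digits)
      ≈⟨ sumL-cartesianProduct (prodAlong g s) digits rest ⟨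
    Σ (map (prodAlong g s) (box N s (suc c))) ∎
    where
    digits = range 0 (suc (N s))
    rest   = box N (suc s) c

module GaussianBinomialTheorem {c ℓ} (R : CommutativeRing c ℓ) where

  open import Data.Nat using (zero; suc; _∸_; _<_; z≤n; s≤s) renaming (_+_ to _+ℕ_; _*_ to _*ℕ_)
  open import Data.Nat.Properties using (*-zeroʳ; *-suc; +-∸-assoc; ≤-refl; m<n⇒m<1+n; ≤-pred; <-cmp; <⇒≱)
  open import Relation.Nullary using (contradiction)
  open import Data.Nat.Combinatorics using (_C_; nCk+nC[k+1]≡[n+1]C[k+1]; nC1≡n; k>n⇒nCk≡0)
  open import Data.Product using (proj₂)
  open import Function using (_∘_)
  open import Relation.Binary.Definitions using (tri<; tri≈; tri>)
  import Relation.Binary.PropositionalEquality as ≡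
  open ≡ using (_≡_)
  open CommutativeRing R hiding (zero)
  open import Relation.Binary.Reasoning.Setoid setoid
  open import Algebra.Properties.Ring ring using (-1*x≈-x)
  open import Algebra.Properties.CommutativeSemigroup +-commutativeSemigroup using (x∙yz≈y∙xz)
  open import Algebra.Solver.CommutativeMonoid *-commutativeMonoid using (Expr; solve; _⊜_; _⊕_; id)
  open Range
  open BigOperators R

  -- _⊕_ with the fixity of _*_, so that solver expressions denote our terms up to ≡.
  infixl 7 _⊗_
  _⊗_ : ∀ {n} → Expr n → Expr n → Expr n
  _⊗_ = _⊕_

  qbinom-> : ∀ q {n k} → n < k → qbinom R q n k ≈ 0#
  qbinom-> q {zero}  {suc k} _         = refl
  qbinom-> q {suc n} {suc k} (s≤s n<k) = trans
    (+-cong (qbinom-> q n<k) (trans (*-congˡ (qbinom-> q (m<n⇒m<1+n n<k))) (zeroʳ _)))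
    (+-identityˡ _)

  choose2-suc : ∀ k → suc k C 2 ≡ k +ℕ k C 2
  choose2-suc k = ≡.trans (≡.sym (nCk+nC[k+1]≡[n+1]C[k+1] k 1)) (≡.cong (_+ℕ k C 2) (nC1≡n k))

  module _ (q x y : Carrier) where

    -- monomial a n k * [n k]_q is the k-th term of the expansion of ∏_{j=a}^{a+n-1} (x - q^j y).
    monomial : ℕ → ℕ → ℕ → Carrier
    monomial a n k = pow R x (n ∸ k) * pow R y k * pow R (- 1#) k * pow R q (k C 2) * pow R q (a *ℕ k)

    expansionTerm : ℕ → ℕ → ℕ → Carrier
    expansionTerm a n k = monomial a n k * qbinom R q n k

    monomial-head : ∀ a n → monomial a (suc n) 0 ≈ x * monomial (suc a) n 0
    monomial-head a n = begin
      x * X * 1# * 1# * pow R q (0 C 2) * pow R q (a *ℕ 0)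
        ≈⟨ *-congˡ (pow-cong q (≡.trans (*-zeroʳ a) (≡.sym (*-zeroʳ (suc a))))) ⟩
      x * X * 1# * 1# * T * pow R q (suc a *ℕ 0)
        ≈⟨ solve 4 (λ x X T A → x ⊗ X ⊗ id ⊗ id ⊗ T ⊗ A ⊜ x ⊗ (X ⊗ id ⊗ id ⊗ T ⊗ A)) refl x X T _ ⟩
      x * (X * 1# * 1# * T * pow R q (suc a *ℕ 0)) ∎
      where
      X = pow R x n
      T = pow R q (0 C 2)

    monomial-step : ∀ a n k → monomial a (suc n) (suc k) ≈ - (pow R q a * y) * monomial (suc a) n k
    monomial-step a n k = begin
      X * (y * Y) * (m * S) * pow R q (suc k C 2) * pow R q (a *ℕ suc k)
        ≈⟨ *-cong (*-congˡ (trans (pow-cong q (choose2-suc k)) (pow-+ q k (k C 2))))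
                  (trans (pow-cong q (*-suc a k)) (pow-+ q a (a *ℕ k))) ⟩
      X * (y * Y) * (m * S) * (Qk * T) * (Qa * A)
        ≈⟨ solve 9 (λ X y Y m S Qk T Qa A →
             X ⊗ (y ⊗ Y) ⊗ (m ⊗ S) ⊗ (Qk ⊗ T) ⊗ (Qa ⊗ A) ⊜ (m ⊗ (Qa ⊗ y)) ⊗ (X ⊗ Y ⊗ S ⊗ T ⊗ (Qk ⊗ A)))
             refl X y Y m S Qk T Qa A ⟩
      (m * (Qa * y)) * (X * Y * S * T * (Qk * A))
        ≈⟨ *-cong (-1*x≈-x (Qa * y)) (*-congˡ (sym (pow-+ q k (a *ℕ k)))) ⟩
      - (Qa * y) * (X * Y * S * T * pow R q (suc a *ℕ k)) ∎
      where
      X = pow R x (n ∸ k)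
      Y = pow R y k
      m = - 1#
      S = pow R (- 1#) k
      Qk = pow R q k
      T = pow R q (k C 2)
      Qa = pow R q a
      A = pow R q (a *ℕ k)

    monomial-step-x : ∀ a n k → k < n → monomial a (suc n) (suc k) * pow R q (suc k) ≈ x * monomial (suc a) n (suc k)
    monomial-step-x a n k k<n = begin
      X * Y * S * T * A * Q
        ≈⟨ *-congʳ (*-congʳ (*-congʳ (*-congʳ (*-congʳ (pow-cong x (+-∸-assoc 1 k<n)))))) ⟩
      (x * X′) * Y * S * T * A * Q
        ≈⟨ solve 7 (λ x X′ Y S T A Q → (x ⊗ X′) ⊗ Y ⊗ S ⊗ T ⊗ A ⊗ Q ⊜ x ⊗ (X′ ⊗ Y ⊗ S ⊗ T ⊗ (Q ⊗ A)))
             refl x X′ Y S T A Q ⟩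
      x * (X′ * Y * S * T * (Q * A))
        ≈⟨ *-congˡ (*-congˡ (sym (pow-+ q (suc k) (a *ℕ suc k)))) ⟩
      x * (X′ * Y * S * T * pow R q (suc a *ℕ suc k)) ∎
      where
      X = pow R x (n ∸ k)
      X′ = pow R x (n ∸ suc k)
      Y = pow R y (suc k)
      S = pow R (- 1#) (suc k)
      T = pow R q (suc k C 2)
      A = pow R q (a *ℕ suc k)
      Q = pow R q (suc k)

    expansionTerm-beyond : ∀ a n → expansionTerm a n (suc n) ≈ 0#
    expansionTerm-beyond a n = trans (*-congˡ (qbinom-> q {n} ≤-refl)) (zeroʳ _)

    expansionTerm-pascal : ∀ a n k → k < suc n →
      expansionTerm a (suc n) (suc k) ≈ - (pow R q a * y) * expansionTerm (suc a) n k + x * expansionTerm (suc a) n (suc k)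
    expansionTerm-pascal a n k k≤n = begin
      M * (qbinom R q n k + pow R q (suc k) * qbinom R q n (suc k))
        ≈⟨ distribˡ M _ _ ⟩
      M * qbinom R q n k + M * (pow R q (suc k) * qbinom R q n (suc k))
        ≈⟨ +-cong (*-congʳ (monomial-step a n k)) (last (<-cmp k n)) ⟩
      (- (pow R q a * y) * monomial (suc a) n k) * qbinom R q n k + x * expansionTerm (suc a) n (suc k)
        ≈⟨ +-congʳ (*-assoc _ _ _) ⟩
      - (pow R q a * y) * expansionTerm (suc a) n k + x * expansionTerm (suc a) n (suc k) ∎
      where
      M = monomial a (suc n) (suc k)
      last : _ → M * (pow R q (suc k) * qbinom R q n (suc k)) ≈ x * expansionTerm (suc a) n (suc k)
      last (tri< k<n _ _) = begin
        M * (pow R q (suc k) * qbinom R q n (suc k))          ≈⟨ sym (*-assoc _ _ _) ⟩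
        M * pow R q (suc k) * qbinom R q n (suc k)            ≈⟨ *-congʳ (monomial-step-x a n k k<n) ⟩
        x * monomial (suc a) n (suc k) * qbinom R q n (suc k) ≈⟨ *-assoc _ _ _ ⟩
        x * expansionTerm (suc a) n (suc k)                   ∎
      last (tri≈ _ ≡.refl _) = begin
        M * (pow R q (suc k) * qbinom R q k (suc k)) ≈⟨ *-congˡ (trans (*-congˡ (qbinom-> q {k} ≤-refl)) (zeroʳ _)) ⟩
        M * 0#                                      ≈⟨ zeroʳ _ ⟩
        0#                                          ≈⟨ zeroʳ _ ⟨
        x * 0#                                      ≈⟨ *-congˡ (expansionTerm-beyond (suc a) k) ⟨
        x * expansionTerm (suc a) k (suc k)         ∎
      last (tri> _ _ n<k) = contradiction (≤-pred k≤n) (<⇒≱ n<k)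

    q-binomial-theorem : ∀ n a →
      Π (map (λ j → x - pow R q j * y) (range a n)) ≈ Σ (map (expansionTerm a n) (range 0 (suc n)))
    q-binomial-theorem zero    a = begin
      1#                         ≈⟨ solve 0 (id ⊜ id ⊗ id ⊗ id ⊗ id ⊗ id ⊗ id) refl ⟩
      1# * 1# * 1# * 1# * 1# * 1# ≈⟨ *-congʳ (*-cong (*-congˡ (pow-cong q (≡.sym (k>n⇒nCk≡0 {0} {2} (s≤s z≤n)))))
                                                       (pow-cong q (≡.sym (*-zeroʳ a)))) ⟩
      expansionTerm a 0 0        ≈⟨ +-identityʳ _ ⟨
      expansionTerm a 0 0 + 0#   ∎
    q-binomial-theorem (suc n) a = begin
      (x + - qᵃy) * Π (map (λ j → x - pow R q j * y) (range (suc a) n))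
        ≈⟨ *-congˡ (q-binomial-theorem n (suc a)) ⟩
      (x + - qᵃy) * Σ (map E′ ks)
        ≈⟨ distribʳ _ x (- qᵃy) ⟩
      x * Σ (map E′ ks) + - qᵃy * Σ (map E′ ks)
        ≈⟨ +-comm _ _ ⟩
      - qᵃy * Σ (map E′ ks) + x * Σ (map E′ ks)
        ≈⟨ +-congˡ (*-congˡ (trans (sym (+-identityʳ _)) (+-congˡ (sym (expansionTerm-beyond (suc a) n))))) ⟩
      - qᵃy * Σ (map E′ ks) + x * (Σ (map E′ ks) + E′ (suc n))
        ≈⟨ +-congˡ (*-congˡ (sym (sumL-map-range-∷ʳ E′ 0 (suc n)))) ⟩
      - qᵃy * Σ (map E′ ks) + x * (E′ 0 + Σ (map E′ (range 1 (suc n))))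
        ≈⟨ +-congˡ (distribˡ x _ _) ⟩
      - qᵃy * Σ (map E′ ks) + (x * E′ 0 + x * Σ (map E′ (range 1 (suc n))))
        ≈⟨ x∙yz≈y∙xz _ _ _ ⟩
      x * E′ 0 + (- qᵃy * Σ (map E′ ks) + x * Σ (map E′ (range 1 (suc n))))
        ≈⟨ +-cong (sym (*-assoc _ _ _)) (+-cong (*-sumL-distribˡ _ E′ ks) (*-sumL-distribˡ x E′ (range 1 (suc n)))) ⟩
      x * monomial (suc a) n 0 * 1# + (Σ (map (λ k → - qᵃy * E′ k) ks) + Σ (map (λ k → x * E′ k) (range 1 (suc n))))
        ≈⟨ +-cong (*-congʳ (sym (monomial-head a n)))
                  (+-congˡ (reflexive (≡.cong Σ (map-range-suc (λ k → x * E′ k) 0 (suc n))))) ⟩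
      expansionTerm a (suc n) 0 + (Σ (map (λ k → - qᵃy * E′ k) ks) + Σ (map (λ k → x * E′ (suc k)) ks))
        ≈⟨ +-congˡ (sym (sumL-map-+ _ _ ks)) ⟩
      expansionTerm a (suc n) 0 + Σ (map (λ k → - qᵃy * E′ k + x * E′ (suc k)) ks)
        ≈⟨ +-congˡ (sumL-map-cong ks (λ {k} k∈ → sym (expansionTerm-pascal a n k (proj₂ (∈-range⁻ 0 (suc n) k∈))))) ⟩
      expansionTerm a (suc n) 0 + Σ (map (expansionTerm a (suc n) ∘ suc) ks)
        ≈⟨ +-congˡ (reflexive (≡.cong Σ (≡.sym (map-range-suc (expansionTerm a (suc n)) 0 (suc n))))) ⟩
      Σ (map (expansionTerm a (suc n)) (range 0 (suc (suc n)))) ∎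
      where
      qᵃy = pow R q a * y
      E′ = expansionTerm (suc a) n
      ks = range 0 (suc n)

module Expansion {c ℓ} (R : CommutativeRing c ℓ) (l′ : ℕ) (λp : List ℕ) (λ-isPartition : IsPartition λp)
                 (λ₁≤l : firstPart λp ≤ suc l′) (q : CommutativeRing.Carrier R)
                 (x : Vec (CommutativeRing.Carrier R) (suc l′)) where

  open import Data.Nat using (zero; _∸_; _≤?_; _≟_) renaming (_*_ to _*ℕ_)
  open import Data.Nat.Properties using (≤-refl)
  open import Data.Nat.ListAction using (sum)
  open import Data.Nat.Combinatorics using (_C_)
  open import Data.List using (length)
  open import Data.List.Properties using (map-∘; map-cong-local; map-id-local; ≡-dec)
  open import Data.List.Membership.Propositional using (_∈_; _∉_; find)
  open import Data.List.Membership.Propositional.Properties using (∈-map⁺; ∈-map⁻)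
  open import Data.List.Relation.Unary.All using (all?; tabulate)
  open import Data.List.Relation.Unary.All.Properties using (¬All⇒Any¬)
  open import Data.List.Relation.Unary.Unique.Propositional using (Unique)
  import Data.List.Relation.Unary.Unique.Propositional.Properties as Unique
  open import Data.Vec using (toList)
  open import Data.Product using (_,_; proj₁; proj₂)
  open import Function using (_∘_)
  open import Relation.Nullary using (yes; no; ¬_; contradiction)
  import Relation.Binary.PropositionalEquality as ≡
  open ≡ using (_≡_)
  open CommutativeRing R hiding (zero)
  open import Relation.Binary.Reasoning.Setoid setoid
  open Range
  open Box
  open Digits (suc l′) λp λ-isPartition λ₁≤l
  open BigOperators R
  open GaussianBinomialTheorem R
  open import Algebra.Solver.CommutativeMonoid *-commutativeMonoid using (solve; _⊜_; id)

  l : ℕ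
  l = suc l′

  X : ℕ → Carrier
  X = var R (toList x)

  g : ℕ → ℕ → Carrier
  g i = expansionTerm q (X i) (X (i ∸ 1)) (λ' (suc i)) (mult i)

  Rpoly-expanded : Rpoly R l λp x q ≈ Π (map (λ i → Σ (map (g i) (range 0 (suc (mult i))))) (range 1 l))
  Rpoly-expanded = begin
    Π (map factor (fromTo 1 (suc l)))  ≡⟨ ≡.cong (Π ∘ map factor) (fromTo≡range 1 (suc l)) ⟩
    Π (map factor (range 1 l))         ≈⟨ prodL-map-cong (range 1 l) (λ {i} _ → trans
       (reflexive (≡.cong (Π ∘ map (λ j → X i - pow R q j * X (i ∸ 1))) (fromTo≡range (λ' (suc i)) (λ' i))))
       (q-binomial-theorem q (X i) (X (i ∸ 1)) (mult i) (λ' (suc i)))) ⟩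
    Π (map (λ i → Σ (map (g i) (range 0 (suc (mult i))))) (range 1 l)) ∎
    where
    factor : ℕ → Carrier
    factor i = prodRange R (λ' (suc i)) (λ' i) λ j → X i - pow R q j * X (i ∸ 1)

  module TermOfDigits {ks : List ℕ} (ks∈ : Digits ks) where

    μ : List ℕ
    μ = fromDigits ks

    k : ℕ → ℕ
    k = part ks

    μ' : ℕ → ℕ
    μ' = conj μ

    a b sign choose shift binom : ℕ → Carrier
    a i      = pow R (X i) (mult i ∸ k i)
    b i      = pow R (X (i ∸ 1)) (k i)
    sign i   = pow R (- 1#) (k i)
    choose i = pow R q (k i C 2)
    shift i  = pow R q (λ' (suc i) *ℕ k i)
    binom i  = qbinom R q (mult i) (k i)

    Π[1,l] : (ℕ → Carrier) → Carrier
    Π[1,l] f = Π (map f (range 1 l))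

    prodAlong≈ : prodAlong g 1 ks ≈ Π[1,l] (λ i → g i (k i))
    prodAlong≈ = begin
      prodAlong g 1 ks                            ≈⟨ prodAlong-part g 1 ks ⟩
      Π (map (g′ ∘ suc) (range 0 (length ks)))    ≡⟨ ≡.cong (λ n → Π (map (g′ ∘ suc) (range 0 n))) (InBox-length mult 1 l ks ks∈) ⟩
      Π (map (g′ ∘ suc) (range 0 l))              ≡⟨ ≡.cong Π (map-range-suc g′ 0 l) ⟨
      Π[1,l] g′                                   ∎
      where
      g′ : ℕ → Carrier
      g′ i = g i (k i)

    split : Π[1,l] (λ i → g i (k i)) ≈ Π[1,l] a * Π[1,l] b * Π[1,l] sign * Π[1,l] choose * Π[1,l] shift * Π[1,l] binom
    split = begin
      Π[1,l] (λ i → a i * b i * sign i * choose i * shift i * binom i)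
        ≈⟨ prodL-map-* _ binom (range 1 l) ⟩
      Π[1,l] (λ i → a i * b i * sign i * choose i * shift i) * Π[1,l] binom
        ≈⟨ *-congʳ (prodL-map-* _ shift (range 1 l)) ⟩
      Π[1,l] (λ i → a i * b i * sign i * choose i) * Π[1,l] shift * Π[1,l] binom
        ≈⟨ *-congʳ (*-congʳ (prodL-map-* _ choose (range 1 l))) ⟩
      Π[1,l] (λ i → a i * b i * sign i) * Π[1,l] choose * Π[1,l] shift * Π[1,l] binom
        ≈⟨ *-congʳ (*-congʳ (*-congʳ (prodL-map-* _ sign (range 1 l)))) ⟩
      Π[1,l] (λ i → a i * b i) * Π[1,l] sign * Π[1,l] choose * Π[1,l] shift * Π[1,l] binom
        ≈⟨ *-congʳ (*-congʳ (*-congʳ (*-congʳ (prodL-map-* a b (range 1 l))))) ⟩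
      Π[1,l] a * Π[1,l] b * Π[1,l] sign * Π[1,l] choose * Π[1,l] shift * Π[1,l] binom ∎

    monomialPart : prodRange R 1 l (λ i → pow R (X i) (μ' i ∸ μ' (suc i))) * pow R (X l) (μ' l) ≈ Π[1,l] a * Π[1,l] b
    monomialPart = begin
      Π (map e (fromTo 1 l)) * pow R (X l) (μ' l)
        ≡⟨ ≡.cong (λ is → Π (map e is) * pow R (X l) (μ' l)) (fromTo≡range 1 l) ⟩
      Π (map e (range 1 l′)) * pow R (X l) (μ' l)
        ≈⟨ *-cong (prodL-map-cong (range 1 l′) e≈) (pow-cong (X l) (conj-fromDigits-last ks∈ l′ ≤-refl)) ⟩
      Π (map (λ i → a i * b (suc i)) (range 1 l′)) * a l
        ≈⟨ *-congʳ (prodL-map-* a (b ∘ suc) (range 1 l′)) ⟩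
      Π (map a (range 1 l′)) * Π (map (b ∘ suc) (range 1 l′)) * a l
        ≈⟨ solve 3 (λ A B aₗ → A ⊗ B ⊗ aₗ ⊜ (A ⊗ aₗ) ⊗ (id ⊗ B)) refl _ _ _ ⟩
      Π (map a (range 1 l′)) * a l * (1# * Π (map (b ∘ suc) (range 1 l′)))
        ≈⟨ *-cong (sym (prodL-map-range-∷ʳ a 1 l′))
                  (*-cong (sym (pow-1# (k 1))) (reflexive (≡.cong Π (≡.sym (map-range-suc b 1 l′))))) ⟩
      Π[1,l] a * Π[1,l] b ∎
      where
      e : ℕ → Carrier
      e i = pow R (X i) (μ' i ∸ μ' (suc i))
      e≈ : ∀ {i} → i ∈ range 1 l′ → e i ≈ a i * b (suc i)
      e≈ {zero}  0∈ = contradiction (proj₁ (∈-range⁻ 1 l′ 0∈)) λ ()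
      e≈ {suc j} _  = trans (pow-cong (X (suc j)) (conj-fromDigits-step ks∈ j))
                            (pow-+ (X (suc j)) (mult (suc j) ∸ k (suc j)) (k (suc (suc j))))

    signPart : pow R (- 1#) (size λp ∸ size μ) ≈ Π[1,l] sign
    signPart = trans (pow-cong (- 1#) (size-fromDigits ks∈)) (pow-sum (- 1#) k (range 1 l))

    choosePart : pow R q (sum (map (λ i → (λ' i ∸ μ' i) C 2) (fromTo 1 (suc l)))) ≈ Π[1,l] choose
    choosePart = trans
      (pow-cong q (≡.cong sum (≡.trans (≡.cong (map _) (fromTo≡range 1 (suc l)))
                                       (map-digits-fromDigits ks∈ (λ _ n → n C 2)))))
      (pow-sum q (λ i → k i C 2) (range 1 l))

    shiftPart : pow R q (sum (map (λ i → λ' (suc i) *ℕ (λ' i ∸ μ' i)) (fromTo 1 l))) ≈ Π[1,l] shift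
    shiftPart = begin
      pow R q (sum (map (λ i → λ' (suc i) *ℕ (λ' i ∸ μ' i)) (fromTo 1 l)))
        ≡⟨ ≡.cong (pow R q ∘ sum) (≡.trans (≡.cong (map _) (fromTo≡range 1 l)) (map-cong-local
             (All-range 1 l′ λ { {suc j} _ _ → ≡.cong (λ' (suc (suc j)) *ℕ_) (digit-fromDigits ks∈ j) }))) ⟩
      pow R q (sum (map (λ i → λ' (suc i) *ℕ k i) (range 1 l′)))
        ≈⟨ pow-sum q (λ i → λ' (suc i) *ℕ k i) (range 1 l′) ⟩
      Π (map shift (range 1 l′))
        ≈⟨ *-identityʳ _ ⟨
      Π (map shift (range 1 l′)) * 1#
        ≈⟨ *-congˡ (pow-cong q (≡.cong (_*ℕ k l) (λ'-beyond l ≤-refl))) ⟨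
      Π (map shift (range 1 l′)) * shift l
        ≈⟨ prodL-map-range-∷ʳ shift 1 l′ ⟨
      Π[1,l] shift ∎

    binomialPart : prodRange R 1 (suc l) (λ i → qbinom R q (λ' i ∸ λ' (suc i)) (λ' i ∸ μ' i)) ≈ Π[1,l] binom
    binomialPart = reflexive (≡.cong Π (≡.trans (≡.cong (map _) (fromTo≡range 1 (suc l)))
                                                (map-digits-fromDigits ks∈ (λ i → qbinom R q (mult i)))))

    term≈prodAlong : term R l λp x q μ ≈ prodAlong g 1 ks
    term≈prodAlong = begin
      term R l λp x q μ
        ≈⟨ *-cong (*-cong (*-cong (*-cong monomialPart signPart) choosePart) shiftPart) binomialPart ⟩
      Π[1,l] a * Π[1,l] b * Π[1,l] sign * Π[1,l] choose * Π[1,l] shift * Π[1,l] binom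
        ≈⟨ split ⟨
      Π[1,l] (λ i → g i (k i))
        ≈⟨ prodAlong≈ ⟨
      prodAlong g 1 ks ∎

  term-vanishes : ∀ μ {i} → i ∈ range 1 l → ¬ λ' (suc i) ≤ conj μ i → term R l λp x q μ ≈ 0#
  term-vanishes μ {i} i∈ not-strip = trans (*-congˡ (prodL-map-zero _ (fromTo 1 (suc l)) i∈fromTo binom≈0)) (zeroʳ _)
    where
    i∈fromTo = ≡.subst (i ∈_) (≡.sym (fromTo≡range 1 (suc l))) i∈
    binom≈0 = qbinom-> q (not-strip⇒mult< μ i not-strip)

  verticalStrips : List (List ℕ)
  verticalStrips = map fromDigits (box mult 1 l)

  sumL-box≈sumL-verticalStrips : Σ (map (prodAlong g 1) (box mult 1 l)) ≈ Σ (map (term R l λp x q) verticalStrips)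
  sumL-box≈sumL-verticalStrips = begin
    Σ (map (prodAlong g 1) (box mult 1 l))
      ≈⟨ sumL-map-cong (box mult 1 l) (λ {ks} ks∈ → sym (TermOfDigits.term≈prodAlong (∈box⇒InBox mult 1 l ks ks∈))) ⟩
    Σ (map (term R l λp x q ∘ fromDigits) (box mult 1 l))
      ≡⟨ ≡.cong Σ (map-∘ (box mult 1 l)) ⟩
    Σ (map (term R l λp x q) verticalStrips) ∎

  verticalStrips-unique : Unique verticalStrips
  verticalStrips-unique = Unique.map⁻ (≡.subst Unique (≡.sym toDigits∘fromDigits≡id) (box-unique mult 1 l))
    where
    toDigits∘fromDigits≡id : map toDigits verticalStrips ≡ box mult 1 l
    toDigits∘fromDigits≡id = ≡.trans (≡.sym (map-∘ (box mult 1 l)))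
      (map-id-local (tabulate λ {ks} ks∈ → toDigits-fromDigits (∈box⇒InBox mult 1 l ks ks∈)))

  sumL-enumeration≈sumL-verticalStrips : ∀ L → EnumeratesSubpartitions R λp L →
    Σ (map (term R l λp x q) L) ≈ Σ (map (term R l λp x q) verticalStrips)
  sumL-enumeration≈sumL-verticalStrips L (L-unique , L-enumerates) =
    sumL-unique-⊆ (term R l λp x q) (≡-dec _≟_) L-unique verticalStrips-unique strip∈L vanish
    where
    strip∈L : ∀ {μ} → μ ∈ verticalStrips → μ ∈ L
    strip∈L μ∈ with ks , ks∈ , ≡.refl ← ∈-map⁻ fromDigits μ∈ =
      proj₂ (L-enumerates _) (fromDigits-isPartition digits , fromDigits-⊆ digits)
      where digits = ∈box⇒InBox mult 1 l ks ks∈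
    vanish : ∀ {μ} → μ ∈ L → μ ∉ verticalStrips → term R l λp x q μ ≈ 0#
    vanish {μ} μ∈L μ∉ with proj₁ (L-enumerates μ) μ∈L | all? (λ i → λ' (suc i) ≤? conj μ i) (range 1 l)
    ... | μ-isPartition , μ⊆λ | yes strip = contradiction
      (≡.subst (_∈ verticalStrips) (fromDigits-toDigits μ-isPartition μ⊆λ strip)
        (∈-map⁺ fromDigits (InBox⇒∈box mult 1 l (toDigits μ) (toDigits-digits μ strip)))) μ∉
    ... | _ | no not-strip with i , i∈ , ¬strip ← find (¬All⇒Any¬ (λ i → λ' (suc i) ≤? conj μ i) (range 1 l) not-strip) =
      term-vanishes μ i∈ ¬strip

proposition2 : {c ℓ' : Level} (R : CommutativeRing c ℓ') (l : ℕ) → 1 ≤ l →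
    (p : List ℕ) → IsPartition p → firstPart p ≤ l →
    (L : List (List ℕ)) → EnumeratesSubpartitions R p L →
    (q : CommutativeRing.Carrier R) (x : Vec (CommutativeRing.Carrier R) l) →
    CommutativeRing._≈_ R (Rpoly R l p x q) (sumL R (map (term R l p x q) L))
proposition2 R (suc l′) _ p p-isPartition p₁≤l L L-enumerates q x = begin
  Rpoly R (suc l′) p x q
    ≈⟨ Rpoly-expanded ⟩
  Π (map (λ i → Σ (map (g i) (range 0 (suc (mult i))))) (range 1 (suc l′)))
    ≈⟨ prodL-sumL≈sumL-box g mult 1 (suc l′) ⟩
  Σ (map (prodAlong g 1) (box mult 1 (suc l′)))
    ≈⟨ sumL-box≈sumL-verticalStrips ⟩
  Σ (map (term R (suc l′) p x q) verticalStrips)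
    ≈⟨ sumL-enumeration≈sumL-verticalStrips L L-enumerates ⟨
  Σ (map (term R (suc l′) p x q) L) ∎
  where
  open CommutativeRing R using (setoid)
  open import Relation.Binary.Reasoning.Setoid setoid
  open Range using (range)
  open Box using (box)
  open BigOperators R using (Σ; Π; prodAlong; prodL-sumL≈sumL-box)
  open Digits (suc l′) p p-isPartition p₁≤l using (mult)
  open Expansion R l′ p p-isPartition p₁≤l q x
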